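{- For each integer $k\ge2$ and every finite Fibonacci word $v$, $|\pi_k(v)|\le\bigl(k\,\pi(v)\bigr)^k$.
   Context: Fibonacci words: finite words in $\{1,2\}$; rank $|v|$ = sum of digits; the position of the 2 in $v=v_12v_2$ is $|v_2|+1$. For a word $v$ whose 2's are at positions $d_1<d_2<\cdots$: $\pi(v)=\prod_{j:d_j\ge2}(1-1/d_j)$ and $\pi_k(v)=\prod_{j:d_j\ge k-1}(1-k/d_j)$. -}

module Defs where

open import Data.Bool using (if_then_else_)
open import Data.Nat as ℕ using (ℕ; zero; suc; _∸_; _≤ᵇ_; _+_)
open import Data.Integer using (+_)
open import Data.List using (List; []; _∷_)
open import Data.Rational using (ℚ; 1ℚ; _-_; _*_; _/_)

data Digit : Set where
  one two : Digit

FibWord : Set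
FibWord = List Digit

val : Digit → ℕ
val one = 1
val two = 2

rank : FibWord → ℕ
rank [] = 0
rank (d ∷ v) = val d + rank v

positions : FibWord → List ℕ
positions [] = []
positions (one ∷ v) = positions v
positions (two ∷ v) = suc (rank v) ∷ positions v

factor : (t a d : ℕ) → ℚ
factor t a zero = 1ℚ
factor t a (suc m) = if t ≤ᵇ suc m then 1ℚ - (+ a / suc m) else 1ℚ

prodFactors : (t a : ℕ) → List ℕ → ℚ
prodFactors t a [] = 1ℚ
prodFactors t a (d ∷ ds) = factor t a d * prodFactors t a ds

piW : FibWord → ℚ
piW v = prodFactors 2 1 (positions v)

piK : ℕ → FibWord → ℚ
piK k v = prodFactors (k ∸ 1) k (positions v)

_^ℚ_ : ℚ → ℕ → ℚ
q ^ℚ zero = 1ℚ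
q ^ℚ suc n = q * (q ^ℚ n)

{-# OPTIONS --safe #-}
module Submission where

-- A leading 2 at position d ≥ k contributes 1 - k/d to π_k and
-- 1 - 1/d to π, and 0 ≤ 1 - k/d ≤ (1 - 1/d)^k by Bernoulli's inequality. If instead
-- d < k, the whole word has rank at most k. Then every factor of π_k lies in [-1, 1]
-- (a factor occurs only when d ≥ k - 1 ≥ 1, so k ≤ 2d), while π(v) ≥ 1/m whenever
-- rank v ≤ m: inductively (1 - 1/d) π(rest) ≥ ((d-1)/d) · 1/(d-1) = 1/d, and d < rank v.
-- Hence k π(v) ≥ 1 and |π_k(v)| ≤ 1 ≤ (k π(v))^k.

open import Defs
open import Data.Bool using (true; false; T)
open import Data.Empty using (⊥-elim)
open import Data.Integer as ℤ using (+_)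
import Data.Integer.Properties as ℤ
open import Data.List using ([]; _∷_)
open import Data.Nat as ℕ using (ℕ; zero; suc; _≤_; _∸_; z≤n; s≤s)
import Data.Nat.Properties as ℕ
open import Data.Rational
  using (ℚ; ∣_∣; _*_; _/_; _+_; _-_; -_; 0ℚ; 1ℚ; toℚᵘ; nonNegative)
  renaming (_≤_ to _≤ℚ_)
open import Data.Rational.Properties
  using ( ≤-refl; ≤-reflexive; ≤-trans; module ≤-Reasoning
        ; toℚᵘ-injective; toℚᵘ-fromℚᵘ; toℚᵘ-homo-+; toℚᵘ-homo-*
        ; normalize-nonNeg; nonNegative⁻¹; nonNeg*nonNeg⇒nonNeg
        ; +-monoʳ-≤; +-monoˡ-≤; +-inverseʳ; +-identityʳ; neg-antimono-≤
        ; *-identityˡ; *-identityʳ; *-distribʳ-+; *-monoʳ-≤-nonNeg; *-monoˡ-≤-nonNeg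
        ; 0≤∣p∣; 0≤p⇒∣p∣≡p; ∣p∣≡p∨∣p∣≡-p; ∣p*q∣≡∣p∣*∣q∣; ≤ᵇ⇒≤ )
import Data.Rational.Unnormalised as ℚᵘ
import Data.Rational.Unnormalised.Properties as ℚᵘ
open import Data.Rational.Solver using (module +-*-Solver)
open import Data.Sum using (inj₁; inj₂)
open import Data.Unit using (tt)
open import Relation.Nullary using (¬_; yes; no)
open import Relation.Binary.PropositionalEquality

open +-*-Solver

fromℕ : ℕ → ℚ
fromℕ n = + n / 1

toℚᵘ-/ : ∀ i n → toℚᵘ (i / suc n) ℚᵘ.≃ ℚᵘ.mkℚᵘ i n
toℚᵘ-/ i n = toℚᵘ-fromℚᵘ (ℚᵘ.mkℚᵘ i n)

fromℕ-+ : ∀ m n → fromℕ (m ℕ.+ n) ≡ fromℕ m + fromℕ n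
fromℕ-+ m n = toℚᵘ-injective (begin
  toℚᵘ (fromℕ (m ℕ.+ n))                  ≈⟨ toℚᵘ-/ (+ (m ℕ.+ n)) 0 ⟩
  ℚᵘ.mkℚᵘ (+ (m ℕ.+ n)) 0                ≈⟨ ℚᵘ.*≡* integers ⟩
  ℚᵘ.mkℚᵘ (+ m) 0 ℚᵘ.+ ℚᵘ.mkℚᵘ (+ n) 0    ≈⟨ ℚᵘ.+-cong (toℚᵘ-/ (+ m) 0) (toℚᵘ-/ (+ n) 0) ⟨
  toℚᵘ (fromℕ m) ℚᵘ.+ toℚᵘ (fromℕ n)      ≈⟨ toℚᵘ-homo-+ (fromℕ m) (fromℕ n) ⟨
  toℚᵘ (fromℕ m + fromℕ n)                ∎)
  where
  open ℚᵘ.≃-Reasoning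
  integers : + (m ℕ.+ n) ℤ.* + 1 ≡ (+ m ℤ.* + 1 ℤ.+ + n ℤ.* + 1) ℤ.* + 1
  integers rewrite ℤ.*-identityʳ (+ m) | ℤ.*-identityʳ (+ n) = cong (ℤ._* + 1) (ℤ.pos-+ m n)

a/d≡a*[1/d] : ∀ a n → + a / suc n ≡ fromℕ a * (+ 1 / suc n)
a/d≡a*[1/d] a n = toℚᵘ-injective (begin
  toℚᵘ (+ a / suc n)                         ≈⟨ toℚᵘ-/ (+ a) n ⟩
  ℚᵘ.mkℚᵘ (+ a) n                            ≈⟨ ℚᵘ.*≡* integers ⟩
  ℚᵘ.mkℚᵘ (+ a) 0 ℚᵘ.* ℚᵘ.mkℚᵘ (+ 1) n        ≈⟨ ℚᵘ.*-cong (toℚᵘ-/ (+ a) 0) (toℚᵘ-/ (+ 1) n) ⟨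
  toℚᵘ (fromℕ a) ℚᵘ.* toℚᵘ (+ 1 / suc n)     ≈⟨ toℚᵘ-homo-* (fromℕ a) (+ 1 / suc n) ⟨
  toℚᵘ (fromℕ a * (+ 1 / suc n))             ∎)
  where
  open ℚᵘ.≃-Reasoning
  integers : + a ℤ.* + suc (n ℕ.+ 0) ≡ (+ a ℤ.* + 1) ℤ.* + suc n
  integers rewrite ℕ.+-identityʳ n | ℤ.*-identityʳ (+ a) = refl

d/d≡1 : ∀ n → + suc n / suc n ≡ 1ℚ
d/d≡1 n = toℚᵘ-injective (ℚᵘ.≃-trans (toℚᵘ-/ (+ suc n) n) (ℚᵘ.*≡* (ℤ.*-comm (+ suc n) (+ 1))))

d*[1/d]≡1 : ∀ n → fromℕ (suc n) * (+ 1 / suc n) ≡ 1ℚ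
d*[1/d]≡1 n = trans (sym (a/d≡a*[1/d] (suc n) n)) (d/d≡1 n)

0≤fromℕ : ∀ n → 0ℚ ≤ℚ fromℕ n
0≤fromℕ n = nonNegative⁻¹ (fromℕ n) {{normalize-nonNeg n 1}}

0≤1/d : ∀ n → 0ℚ ≤ℚ + 1 / suc n
0≤1/d n = nonNegative⁻¹ (+ 1 / suc n) {{normalize-nonNeg 1 (suc n)}}

*-nonNeg : ∀ {p q} → 0ℚ ≤ℚ p → 0ℚ ≤ℚ q → 0ℚ ≤ℚ p * q
*-nonNeg {p} {q} 0≤p 0≤q =
  nonNegative⁻¹ (p * q) {{nonNeg*nonNeg⇒nonNeg p {{nonNegative 0≤p}} q {{nonNegative 0≤q}}}}

*-mono-≤-nonNeg : ∀ {p q r s} → 0ℚ ≤ℚ p → 0ℚ ≤ℚ r → p ≤ℚ q → r ≤ℚ s → p * r ≤ℚ q * s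
*-mono-≤-nonNeg {q = q} {r = r} 0≤p 0≤r p≤q r≤s =
  ≤-trans (*-monoʳ-≤-nonNeg r {{nonNegative 0≤r}} p≤q)
          (*-monoˡ-≤-nonNeg q {{nonNegative (≤-trans 0≤p p≤q)}} r≤s)

p≤p+q : ∀ p {q} → 0ℚ ≤ℚ q → p ≤ℚ p + q
p≤p+q p 0≤q = ≤-trans (≤-reflexive (sym (+-identityʳ p))) (+-monoʳ-≤ p 0≤q)

p≤q⇒0≤q-p : ∀ {p q} → p ≤ℚ q → 0ℚ ≤ℚ q - p
p≤q⇒0≤q-p {p} p≤q = ≤-trans (≤-reflexive (sym (+-inverseʳ p))) (+-monoˡ-≤ (- p) p≤q)

fromℕ-mono-≤ : ∀ {m n} → m ≤ n → fromℕ m ≤ℚ fromℕ n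
fromℕ-mono-≤ {m} {n} m≤n = begin
  fromℕ m                   ≤⟨ p≤p+q (fromℕ m) (0≤fromℕ (n ∸ m)) ⟩
  fromℕ m + fromℕ (n ∸ m)   ≡⟨ fromℕ-+ m (n ∸ m) ⟨
  fromℕ (m ℕ.+ (n ∸ m))     ≡⟨ cong fromℕ (ℕ.m+[n∸m]≡n m≤n) ⟩
  fromℕ n                   ∎
  where open ≤-Reasoning

a≤b⇒a/d≤b/d : ∀ {a b} n → a ≤ b → fromℕ a * (+ 1 / suc n) ≤ℚ fromℕ b * (+ 1 / suc n)
a≤b⇒a/d≤b/d n a≤b = *-monoʳ-≤-nonNeg (+ 1 / suc n) {{nonNegative (0≤1/d n)}} (fromℕ-mono-≤ a≤b)

a≤d⇒a/d≤1 : ∀ {a} n → a ≤ suc n → fromℕ a * (+ 1 / suc n) ≤ℚ 1ℚ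
a≤d⇒a/d≤1 n a≤d = ≤-trans (a≤b⇒a/d≤b/d n a≤d) (≤-reflexive (d*[1/d]≡1 n))

a≤2d⇒a/d≤2 : ∀ {a} n → a ≤ suc n ℕ.+ suc n → fromℕ a * (+ 1 / suc n) ≤ℚ 1ℚ + 1ℚ
a≤2d⇒a/d≤2 {a} n a≤2d = begin
  fromℕ a * u                          ≤⟨ a≤b⇒a/d≤b/d n a≤2d ⟩
  fromℕ (suc n ℕ.+ suc n) * u          ≡⟨ cong (_* u) (fromℕ-+ (suc n) (suc n)) ⟩
  (fromℕ (suc n) + fromℕ (suc n)) * u  ≡⟨ *-distribʳ-+ u (fromℕ (suc n)) (fromℕ (suc n)) ⟩
  fromℕ (suc n) * u + fromℕ (suc n) * u ≡⟨ cong₂ _+_ (d*[1/d]≡1 n) (d*[1/d]≡1 n) ⟩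
  1ℚ + 1ℚ                              ∎
  where
  open ≤-Reasoning
  u : ℚ
  u = + 1 / suc n

1-1/d≡[d-1]/d : ∀ n → 1ℚ - + 1 / suc n ≡ fromℕ n * (+ 1 / suc n)
1-1/d≡[d-1]/d n = begin
  1ℚ - u                   ≡⟨ cong (_- u) (d*[1/d]≡1 n) ⟨
  fromℕ (suc n) * u - u    ≡⟨ cong (λ x → x * u - u) (fromℕ-+ 1 n) ⟩
  (1ℚ + fromℕ n) * u - u   ≡⟨ solve 2 (λ N u → (con 1ℚ :+ N) :* u :- u := N :* u) refl (fromℕ n) u ⟩
  fromℕ n * u              ∎
  where
  open ≡-Reasoning
  u : ℚ
  u = + 1 / suc n

^ℚ-distribʳ-* : ∀ p q n → (p * q) ^ℚ n ≡ p ^ℚ n * q ^ℚ n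
^ℚ-distribʳ-* p q zero = refl
^ℚ-distribʳ-* p q (suc n) = trans (cong ((p * q) *_) (^ℚ-distribʳ-* p q n))
  (solve 4 (λ p q a b → (p :* q) :* (a :* b) := (p :* a) :* (q :* b)) refl p q (p ^ℚ n) (q ^ℚ n))

0≤1ℚ : 0ℚ ≤ℚ 1ℚ
0≤1ℚ = ≤ᵇ⇒≤ tt

1≤p⇒1≤p^n : ∀ {p} n → 1ℚ ≤ℚ p → 1ℚ ≤ℚ p ^ℚ n
1≤p⇒1≤p^n zero 1≤p = ≤-refl
1≤p⇒1≤p^n (suc n) 1≤p = *-mono-≤-nonNeg 0≤1ℚ 0≤1ℚ 1≤p (1≤p⇒1≤p^n n 1≤p)

bernoulli : ∀ n {u} → 0ℚ ≤ℚ u → u ≤ℚ 1ℚ → 1ℚ - fromℕ n * u ≤ℚ (1ℚ - u) ^ℚ n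
bernoulli zero {u} 0≤u u≤1 = ≤-reflexive (solve 1 (λ u → con 1ℚ :- con 0ℚ :* u := con 1ℚ) refl u)
bernoulli (suc n) {u} 0≤u u≤1 = begin
  1ℚ - fromℕ (suc n) * u                       ≡⟨ cong (λ x → 1ℚ - x * u) (fromℕ-+ 1 n) ⟩
  1ℚ - (1ℚ + N) * u                            ≤⟨ p≤p+q _ (*-nonNeg (*-nonNeg (0≤fromℕ n) 0≤u) 0≤u) ⟩
  1ℚ - (1ℚ + N) * u + N * u * u                ≡⟨ solve 2 (λ N u → con 1ℚ :- (con 1ℚ :+ N) :* u :+ N :* u :* u
                                                               := (con 1ℚ :- u) :* (con 1ℚ :- N :* u)) refl N u ⟩
  (1ℚ - u) * (1ℚ - N * u)                      ≤⟨ *-monoˡ-≤-nonNeg (1ℚ - u) {{nonNegative (p≤q⇒0≤q-p u≤1)}}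
                                                    (bernoulli n 0≤u u≤1) ⟩
  (1ℚ - u) * (1ℚ - u) ^ℚ n                     ∎
  where
  open ≤-Reasoning
  N : ℚ
  N = fromℕ n

∣1-p∣≤1 : ∀ {p} → 0ℚ ≤ℚ p → p ≤ℚ 1ℚ + 1ℚ → ∣ 1ℚ - p ∣ ≤ℚ 1ℚ
∣1-p∣≤1 {p} 0≤p p≤2 with ∣p∣≡p∨∣p∣≡-p (1ℚ - p)
... | inj₁ ∣1-p∣≡1-p = ≤-trans (≤-reflexive ∣1-p∣≡1-p) (+-monoʳ-≤ 1ℚ (neg-antimono-≤ 0≤p))
... | inj₂ ∣1-p∣≡p-1 = begin
  ∣ 1ℚ - p ∣         ≡⟨ ∣1-p∣≡p-1 ⟩
  - (1ℚ - p)         ≡⟨ solve 1 (λ p → :- (con 1ℚ :- p) := p :- con 1ℚ) refl p ⟩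
  p - 1ℚ             ≤⟨ +-monoˡ-≤ (- 1ℚ) p≤2 ⟩
  1ℚ + 1ℚ - 1ℚ       ≡⟨ solve 0 (con 1ℚ :+ con 1ℚ :- con 1ℚ := con 1ℚ) refl ⟩
  1ℚ                 ∎
  where open ≤-Reasoning

factor-≥ : ∀ {t} a n → t ≤ suc n → factor t a (suc n) ≡ 1ℚ - + a / suc n
factor-≥ {t} a n t≤d with t ℕ.≤ᵇ suc n | ℕ.≤⇒≤ᵇ t≤d
... | true | _ = refl

factor-< : ∀ {t} a n → ¬ t ≤ suc n → factor t a (suc n) ≡ 1ℚ
factor-< {t} a n t≰d with t ℕ.≤ᵇ suc n in eq
... | false = refl
... | true = ⊥-elim (t≰d (ℕ.≤ᵇ⇒≤ t (suc n) (subst T (sym eq) tt)))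

∣factorₖ∣≤1 : ∀ {k} → 2 ≤ k → ∀ d → ∣ factor (k ∸ 1) k d ∣ ≤ℚ 1ℚ
∣factorₖ∣≤1 _ zero = ≤-refl
∣factorₖ∣≤1 {suc k} (s≤s _) (suc n) with k ℕ.≤? suc n
... | yes k≤d rewrite factor-≥ (suc k) n k≤d | a/d≡a*[1/d] (suc k) n =
  ∣1-p∣≤1 (*-nonNeg (0≤fromℕ (suc k)) (0≤1/d n))
          (a≤2d⇒a/d≤2 n (ℕ.≤-trans (s≤s k≤d) (s≤s (ℕ.m≤n+m (suc n) n))))
... | no k≰d rewrite factor-< (suc k) n k≰d = ≤-refl

∣prodFactorsₖ∣≤1 : ∀ {k} → 2 ≤ k → ∀ ds → ∣ prodFactors (k ∸ 1) k ds ∣ ≤ℚ 1ℚ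
∣prodFactorsₖ∣≤1 2≤k [] = ≤-refl
∣prodFactorsₖ∣≤1 {k} 2≤k (d ∷ ds) = begin
  ∣ factor (k ∸ 1) k d * prodFactors (k ∸ 1) k ds ∣      ≡⟨ ∣p*q∣≡∣p∣*∣q∣ (factor (k ∸ 1) k d) _ ⟩
  ∣ factor (k ∸ 1) k d ∣ * ∣ prodFactors (k ∸ 1) k ds ∣  ≤⟨ *-mono-≤-nonNeg (0≤∣p∣ _) (0≤∣p∣ _)
                                                              (∣factorₖ∣≤1 2≤k d) (∣prodFactorsₖ∣≤1 2≤k ds) ⟩
  1ℚ * 1ℚ                                                ≡⟨ *-identityˡ 1ℚ ⟩
  1ℚ                                                     ∎
  where open ≤-Reasoning

1≤m*piW : ∀ v {m} → rank v ≤ m → 1 ≤ m → 1ℚ ≤ℚ fromℕ m * piW v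
1≤m*piW [] {m} _ 1≤m = ≤-trans (fromℕ-mono-≤ 1≤m) (≤-reflexive (sym (*-identityʳ (fromℕ m))))
1≤m*piW (one ∷ v) rank≤m 1≤m = 1≤m*piW v (ℕ.≤-trans (ℕ.n≤1+n _) rank≤m) 1≤m
1≤m*piW (two ∷ v) {m} rank≤m 1≤m with 2 ℕ.≤? suc (rank v)
... | no 2≰d rewrite factor-< 1 (rank v) 2≰d | *-identityˡ (piW v) =
  1≤m*piW v (ℕ.≤-trans (ℕ.n≤1+n _) (ℕ.≤-trans (ℕ.n≤1+n _) rank≤m)) 1≤m
... | yes (s≤s 1≤r) = begin
  1ℚ                                   ≡⟨ d*[1/d]≡1 r ⟨
  fromℕ (suc r) * u                    ≤⟨ a≤b⇒a/d≤b/d r (ℕ.≤-trans (ℕ.n≤1+n _) rank≤m) ⟩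
  fromℕ m * u                          ≡⟨ *-identityʳ (fromℕ m * u) ⟨
  fromℕ m * u * 1ℚ                     ≤⟨ *-monoˡ-≤-nonNeg (fromℕ m * u) {{nonNegative (*-nonNeg (0≤fromℕ m) (0≤1/d r))}}
                                            (1≤m*piW v ℕ.≤-refl 1≤r) ⟩
  fromℕ m * u * (fromℕ r * piW v)      ≡⟨ solve 4 (λ M u R B → M :* u :* (R :* B) := M :* ((R :* u) :* B)) refl
                                            (fromℕ m) u (fromℕ r) (piW v) ⟩
  fromℕ m * ((fromℕ r * u) * piW v)    ≡⟨ cong (λ x → fromℕ m * (x * piW v)) (1-1/d≡[d-1]/d r) ⟨
  fromℕ m * ((1ℚ - u) * piW v)         ≡⟨ cong (λ x → fromℕ m * (x * piW v)) (factor-≥ 1 r (s≤s 1≤r)) ⟨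
  fromℕ m * piW (two ∷ v)              ∎
  where
  open ≤-Reasoning
  r : ℕ
  r = rank v
  u : ℚ
  u = + 1 / suc r

∣factorₖ∣≤factor^k : ∀ {k} n → 2 ≤ k → k ≤ suc n → ∣ factor (k ∸ 1) k (suc n) ∣ ≤ℚ factor 2 1 (suc n) ^ℚ k
∣factorₖ∣≤factor^k {k} n 2≤k k≤d = begin
  ∣ factor (k ∸ 1) k (suc n) ∣  ≡⟨ cong ∣_∣ (factor-≥ k n (ℕ.≤-trans (ℕ.m∸n≤m k 1) k≤d)) ⟩
  ∣ 1ℚ - + k / suc n ∣          ≡⟨ cong (λ x → ∣ 1ℚ - x ∣) (a/d≡a*[1/d] k n) ⟩
  ∣ 1ℚ - fromℕ k * u ∣          ≡⟨ 0≤p⇒∣p∣≡p (p≤q⇒0≤q-p (a≤d⇒a/d≤1 n k≤d)) ⟩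
  1ℚ - fromℕ k * u              ≤⟨ bernoulli k (0≤1/d n) u≤1 ⟩
  (1ℚ - u) ^ℚ k                 ≡⟨ cong (_^ℚ k) (factor-≥ 1 n (ℕ.≤-trans 2≤k k≤d)) ⟨
  factor 2 1 (suc n) ^ℚ k       ∎
  where
  open ≤-Reasoning
  u : ℚ
  u = + 1 / suc n
  u≤1 : u ≤ℚ 1ℚ
  u≤1 = subst (_≤ℚ 1ℚ) (*-identityˡ u) (a≤d⇒a/d≤1 n (s≤s z≤n))

∣piK∣≤[k*piW]^k-of-rank≤k : ∀ {k} → 2 ≤ k → ∀ v → rank v ≤ k → ∣ piK k v ∣ ≤ℚ (fromℕ k * piW v) ^ℚ k
∣piK∣≤[k*piW]^k-of-rank≤k {k} 2≤k v rank≤k =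
  ≤-trans (∣prodFactorsₖ∣≤1 2≤k (positions v))
          (1≤p⇒1≤p^n k (1≤m*piW v rank≤k (ℕ.≤-trans (s≤s z≤n) 2≤k)))

lemma8p3 : (k : ℕ) → 2 ≤ k → (v : FibWord) →
    ∣ piK k v ∣ ≤ℚ ((+ k / 1) * piW v) ^ℚ k
lemma8p3 k 2≤k [] = ∣piK∣≤[k*piW]^k-of-rank≤k 2≤k [] z≤n
lemma8p3 k 2≤k (one ∷ v) = lemma8p3 k 2≤k v
lemma8p3 k 2≤k (two ∷ v) with k ℕ.≤? suc (rank v)
... | no k≰d = ∣piK∣≤[k*piW]^k-of-rank≤k 2≤k (two ∷ v) (ℕ.≰⇒> k≰d)
... | yes k≤d = begin
  ∣ fₖ * piK k v ∣                   ≡⟨ ∣p*q∣≡∣p∣*∣q∣ fₖ (piK k v) ⟩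
  ∣ fₖ ∣ * ∣ piK k v ∣               ≤⟨ *-mono-≤-nonNeg (0≤∣p∣ fₖ) (0≤∣p∣ (piK k v))
                                         (∣factorₖ∣≤factor^k (rank v) 2≤k k≤d) (lemma8p3 k 2≤k v) ⟩
  f ^ℚ k * (K * piW v) ^ℚ k          ≡⟨ ^ℚ-distribʳ-* f (K * piW v) k ⟨
  (f * (K * piW v)) ^ℚ k             ≡⟨ cong (_^ℚ k) (solve 3 (λ f K B → f :* (K :* B) := K :* (f :* B)) refl f K (piW v)) ⟩
  (K * (f * piW v)) ^ℚ k             ∎
  where
  open ≤-Reasoning
  K f fₖ : ℚ
  K = fromℕ k
  f = factor 2 1 (suc (rank v))
  fₖ = factor (k ∸ 1) k (suc (rank v))
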